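{- Let $G=(V,E)$ be a strongly connected bidirected graph, let $\mathcal{T}$ be a separator decomposition of $G$, let $\pi$ be a nested dissection order induced by $\mathcal{T}$ with $\mathrm{Rank}(v)=\pi^{ -1}(v)$, and let $H$ be the graph obtained by contracting the vertices of $G$ in the order $\pi$. Let $X$ be a node of $\mathcal{T}$, let $G_X$ be the subgraph of $G$ induced by the vertices contained in the subtree $\mathcal{T}_X$, let $B(X)=\{w\in V\setminus V(G_X) : (v,w)\in E \text{ for some } v\in V(G_X)\}$, and let $u$ be the highest-ranked vertex of $G_X$. Then $B(X)=N_H^{\uparrow}(u)$.
   Context: A graph $G=(V,E)$ is bidirected if $(v,w)\in E$ implies $(w,v)\in E$. A separator decomposition of a strongly connected $n$-vertex bidirected graph $G=(V,E)$ is a rooted tree $\mathcal{T}=(\mathcal{X},\mathcal{E})$ whose nodes $X\in\mathcal{X}$ are pairwise disjoint subsets of $V$, defined recursively: if $n=1$, $\mathcal{T}$ is a single node $X=V$; if $n>1$, $\mathcal{T}$ has a root $X\subseteq V$ such that removing $X$ separates $G$ into strongly connected subgraphs $G_0,\dots,G_{d-1}$ (with no edges of $G$ between different $G_i$), and the children of the root are the roots of separator decompositions of $G_0,\dots,G_{d-1}$. For a node $X$, $\mathcal{T}_X$ denotes the subtree rooted at $X$ and $G_X$ the subgraph of $G$ induced by all vertices contained in nodes of $\mathcal{T}_X$. A nested dissection order $\pi$ induced by $\mathcal{T}$ is obtained by numbering the vertices in the order in which they are visited by a postorder walk of $\mathcal{T}$, where the vertices within each node are visited in an arbitrary order; $\pi^{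 -1}(v)$ is the rank of $v$. Contraction: vertices are processed in increasing rank; to contract a vertex $v$, it is temporarily removed from the current graph and shortcut edges are added between every pair of its remaining (not yet contracted) neighbors. $H$ is the graph consisting of $G$ together with all shortcuts added. $N_H^{\uparrow}(v)$ is the set of neighbors of $v$ in $H$ whose rank is higher than that of $v$. -}

module Defs where

open import Data.Nat using (ℕ; zero; suc; _<_; _≤_)
open import Data.Fin using (Fin; toℕ)
open import Data.List using (List; []; _∷_; _++_; length; lookup)
open import Data.List.Membership.Propositional using (_∈_; _∉_)
open import Data.List.Relation.Unary.All using (All)
open import Data.Product using (Σ; _×_; ∃)
open import Data.Sum using (_⊎_)
open import Relation.Nullary using (¬_)
open import Data.List.Relation.Unary.Unique.Propositional using (Unique)
open import Relation.Binary.PropositionalEquality using (_≡_; _≢_)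
open import Relation.Binary.Construct.Closure.ReflexiveTransitive using (Star)

Graph : ℕ → Set₁
Graph n = Fin n → Fin n → Set

Bidirected : ∀ {n} → Graph n → Set
Bidirected E = ∀ v w → E v w → E w v

Induced : ∀ {n} → Graph n → List (Fin n) → Graph n
Induced E S a b = a ∈ S × b ∈ S × E a b

StronglyConnectedOn : ∀ {n} → Graph n → List (Fin n) → Set
StronglyConnectedOn E S = ∀ a b → a ∈ S → b ∈ S → Star (Induced E S) a b

StronglyConnected : ∀ {n} → Graph n → Set
StronglyConnected E = ∀ a b → Star E a b

-- Rooted trees whose nodes are lists of vertices (the order inside a node and
-- the order of the children are the arbitrary choices of the postorder walk).
data Tree (n : ℕ) : Set where
  node : List (Fin n) → List (Tree n) → Tree n

mutual
  postorder : ∀ {n} → Tree n → List (Fin n)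
  postorder (node X ts) = postorderL ts ++ X

  postorderL : ∀ {n} → List (Tree n) → List (Fin n)
  postorderL [] = []
  postorderL (t ∷ ts) = postorder t ++ postorderL ts

vertsOf : ∀ {n} → Tree n → List (Fin n)
vertsOf = postorder

data SubtreeOf {n} : Tree n → Tree n → Set where
  here  : ∀ {t} → SubtreeOf t t
  there : ∀ {s X ts t} → t ∈ ts → SubtreeOf s t → SubtreeOf s (node X ts)

-- SD E T : T is a separator decomposition of the subgraph of E induced by
-- the vertices of T (which is assumed strongly connected by the caller).
data SD {n} (E : Graph n) : Tree n → Set where
  leaf  : ∀ v → SD E (node (v ∷ []) [])
  inner : ∀ X ts →
          2 ≤ length (vertsOf (node X ts)) →
          All (λ t → StronglyConnectedOn E (vertsOf t)) ts →
          (∀ (i j : Fin (length ts)) → i ≢ j → ∀ a b →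
             a ∈ vertsOf (lookup ts i) → b ∈ vertsOf (lookup ts j) → ¬ E a b) →
          All (SD E) ts →
          SD E (node X ts)

SeparatorDecomposition : ∀ {n} → Graph n → Tree n → Set
SeparatorDecomposition E T =
  Unique (postorder T) × (∀ v → v ∈ postorder T) × SD E T

-- π (position ↦ vertex) is a nested dissection order induced by T, with
-- rank = π⁻¹ : the vertex sequence π 0, π 1, …, π (n-1) is the postorder walk.
NestedDissectionOrder : ∀ {n} → Tree n → (Fin n → Fin n) → (Fin n → Fin n) → Set
NestedDissectionOrder {n} T π rank =
  (∀ i → rank (π i) ≡ i) × (∀ v → π (rank v) ≡ v) ×
  Data.List.tabulate π ≡ postorder T
  where import Data.List

-- Cur E rank k is the edge relation
-- after contracting the vertices of rank < k (G plus all shortcuts added so far).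
Cur : ∀ {n} → Graph n → (Fin n → Fin n) → ℕ → Graph n
Cur E rank zero a b = E a b
Cur E rank (suc k) a b =
  Cur E rank k a b ⊎
  Σ _ (λ v → toℕ (rank v) ≡ k × Cur E rank k v a × Cur E rank k v b ×
             k < toℕ (rank a) × k < toℕ (rank b) × a ≢ b)

H : ∀ {n} → Graph n → (Fin n → Fin n) → Graph n
H {n} E rank = Cur E rank n

UpperNeighbour : ∀ {n} → Graph n → (Fin n → Fin n) → Fin n → Fin n → Set
UpperNeighbour E rank u w = H E rank u w × toℕ (rank u) < toℕ (rank w)

Boundary : ∀ {n} → Graph n → Tree n → Fin n → Set
Boundary E s w = w ∉ vertsOf s × Σ _ (λ v → v ∈ vertsOf s × E v w)

HighestIn : ∀ {n} → (Fin n → Fin n) → Tree n → Fin n → Set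
HighestIn rank s u = u ∈ vertsOf s × (∀ v → v ∈ vertsOf s → toℕ (rank v) ≤ toℕ (rank u))

{-# OPTIONS --safe #-}
-- In a nested dissection order every vertex of B(X) lies in the separator of
-- an ancestor of X, so it comes after all of G_X in the postorder walk and is
-- ranked above u.  Contraction adds an edge between a and b exactly when some
-- path from a to b has all its interior vertices ranked below both ends (the
-- fill-path lemma).  For w ∈ B(X) such a path runs inside the strongly
-- connected G_X, whose vertices other than u are ranked below u.  Conversely,
-- a path from u whose interior is ranked below u can never leave G_X, since
-- the first vertex outside G_X would lie in B(X); so its last interior vertex
-- is a neighbour of w in G_X.
module Submission where

open import Defs
open import Data.Nat using (ℕ; zero; suc; _<_; _≤_; _≤′_; ≤′-refl; ≤′-step; z≤n; s≤s)
open import Data.Nat.Properties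
  using (≤-refl; ≤-reflexive; <⇒≤; <⇒≱; ≤-pred; ≤∧≢⇒<; <-≤-trans; <-irrefl; m<n⇒m<1+n; ≤⇒≤′; ≤′⇒≤)
  renaming (_≟_ to _≟ℕ_)
open import Data.Fin using (Fin; toℕ; zero; suc)
open import Data.Fin.Properties using (_≟_; toℕ-injective; toℕ<n)
open import Data.Product using (_×_; _,_; ∃; ∃₂; proj₁; proj₂)
open import Data.Sum using (_⊎_; inj₁; inj₂)
open import Data.Empty using (⊥-elim)
open import Relation.Nullary using (¬_; yes; no)
open import Relation.Unary using (Pred; Decidable; _⊆_; _∩_; ∁)
open import Relation.Binary.PropositionalEquality
open import Data.List using (List; []; _∷_; _++_; length; lookup; tabulate)
open import Data.List.Properties using (++-assoc; ++-identityʳ; ++-monoid)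
open import Data.List.Membership.Propositional using (_∈_; _∉_)
open import Data.List.Membership.Propositional.Properties using (∈-++⁺ˡ; ∈-++⁺ʳ; ∈-++⁻; ∈-∃++)
import Data.List.Membership.DecPropositional as DecMembership
open import Data.List.Relation.Unary.Any using (here; there; index)
open import Data.List.Relation.Unary.Any.Properties using (lookup-index)
open import Data.List.Relation.Unary.All as All using ()
open import Data.List.Relation.Unary.AllPairs using (_∷_)
open import Data.List.Relation.Unary.Unique.Propositional using (Unique)
open import Relation.Binary.Construct.Closure.ReflexiveTransitive as Star using (Star; ε; _◅_)
open import Tactic.MonoidSolver using (solve)

infix 4 _[_]=_

data _[_]=_ {A : Set} : List A → ℕ → A → Set where
  here  : ∀ {x xs} → (x ∷ xs) [ zero ]= x
  there : ∀ {x y xs i} → xs [ i ]= y → (x ∷ xs) [ suc i ]= y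

[]=⇒∈ : ∀ {A : Set} {xs : List A} {i x} → xs [ i ]= x → x ∈ xs
[]=⇒∈ here      = here refl
[]=⇒∈ (there p) = there ([]=⇒∈ p)

tabulate-[]= : ∀ {A : Set} {n} (f : Fin n → A) (i : Fin n) → tabulate f [ toℕ i ]= f i
tabulate-[]= f zero    = here
tabulate-[]= f (suc i) = there (tabulate-[]= (λ j → f (suc j)) i)

[]=-++-< : ∀ {A : Set} (P : List A) {Q i x} → (P ++ Q) [ i ]= x → x ∉ Q → i < length P
[]=-++-< []      p         x∉Q = ⊥-elim (x∉Q ([]=⇒∈ p))
[]=-++-< (_ ∷ P) here      _   = s≤s z≤n
[]=-++-< (_ ∷ P) (there p) x∉Q = s≤s ([]=-++-< P p x∉Q)

[]=-++-≥ : ∀ {A : Set} (P : List A) {Q i x} → (P ++ Q) [ i ]= x → x ∉ P → length P ≤ i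
[]=-++-≥ []      _         _   = z≤n
[]=-++-≥ (_ ∷ P) here      x∉P = ⊥-elim (x∉P (here refl))
[]=-++-≥ (_ ∷ P) (there p) x∉P = s≤s ([]=-++-≥ P p (λ x∈P → x∉P (there x∈P)))

unique-++-disjoint : ∀ {A : Set} (P : List A) {Q x} → Unique (P ++ Q) → x ∈ P → x ∉ Q
unique-++-disjoint (_ ∷ P) (x∉P++Q ∷ _) (here refl) x∈Q = All.lookup x∉P++Q (∈-++⁺ʳ P x∈Q) refl
unique-++-disjoint (_ ∷ P) (_ ∷ u)      (there x∈P)     = unique-++-disjoint P u x∈P

unique-++-[]=-< : ∀ {A : Set} (P : List A) {Q i j x y} → Unique (P ++ Q) → x ∈ P → y ∈ Q →
                  (P ++ Q) [ i ]= x → (P ++ Q) [ j ]= y → i < j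
unique-++-[]=-< P u x∈P y∈Q p q =
  <-≤-trans ([]=-++-< P p (unique-++-disjoint P u x∈P))
            ([]=-++-≥ P q (λ y∈P → unique-++-disjoint P u y∈P y∈Q))

module _ {n : ℕ} where

  postorderL-++ : (ts₁ ts₂ : List (Tree n)) → postorderL (ts₁ ++ ts₂) ≡ postorderL ts₁ ++ postorderL ts₂
  postorderL-++ []        ts₂ = refl
  postorderL-++ (t ∷ ts₁) ts₂ = trans (cong (postorder t ++_) (postorderL-++ ts₁ ts₂))
                                      (sym (++-assoc (postorder t) (postorderL ts₁) _))

  ∈-postorderL⁺ : ∀ {t : Tree n} {ts x} → t ∈ ts → x ∈ postorder t → x ∈ postorderL ts
  ∈-postorderL⁺ {ts = t ∷ _} (here refl) x∈t = ∈-++⁺ˡ x∈t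
  ∈-postorderL⁺ {ts = t ∷ _} (there t∈ts) x∈t = ∈-++⁺ʳ (postorder t) (∈-postorderL⁺ t∈ts x∈t)

  ∈-postorderL⁻ : ∀ (ts : List (Tree n)) {x} → x ∈ postorderL ts → ∃ λ i → x ∈ postorder (lookup ts i)
  ∈-postorderL⁻ (t ∷ ts) x∈ts with ∈-++⁻ (postorder t) x∈ts
  ... | inj₁ x∈t = zero , x∈t
  ... | inj₂ x∈ts′ with ∈-postorderL⁻ ts x∈ts′
  ...   | i , x∈tᵢ = suc i , x∈tᵢ

  SubtreeOf⇒⊆ : ∀ {s t : Tree n} {x} → SubtreeOf s t → x ∈ postorder s → x ∈ postorder t
  SubtreeOf⇒⊆ here               x∈s = x∈s
  SubtreeOf⇒⊆ (there t∈ts sub) x∈s = ∈-++⁺ˡ (∈-postorderL⁺ t∈ts (SubtreeOf⇒⊆ sub x∈s))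

module _ {n : ℕ} {E : Graph n} where

  StronglyConnected⇒StronglyConnectedOn : ∀ {S} → (∀ v → v ∈ S) → StronglyConnected E → StronglyConnectedOn E S
  StronglyConnected⇒StronglyConnectedOn covers connected a b _ _ =
    Star.map (λ e → covers _ , covers _ , e) (connected a b)

  SD-child : ∀ {X ts t} → SD E (node X ts) → t ∈ ts → SD E t
  SD-child (inner _ _ _ _ _ sds) t∈ts = All.lookup sds t∈ts

  SD-child-connected : ∀ {X ts t} → SD E (node X ts) → t ∈ ts → StronglyConnectedOn E (vertsOf t)
  SD-child-connected (inner _ _ _ scs _ _) t∈ts = All.lookup scs t∈ts

  SD-subtree-connected : ∀ {s t} → SD E t → StronglyConnectedOn E (vertsOf t) →
                         SubtreeOf s t → StronglyConnectedOn E (vertsOf s)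
  SD-subtree-connected sd sc here = sc
  SD-subtree-connected sd sc (there t∈ts sub) =
    SD-subtree-connected (SD-child sd t∈ts) (SD-child-connected sd t∈ts) sub

  SD-neighbour-in-children : ∀ {X ts t x y} → SD E (node X ts) → t ∈ ts →
                             x ∈ postorder t → E x y → y ∈ postorderL ts → y ∈ postorder t
  SD-neighbour-in-children {ts = ts} sd t∈ts x∈t e y∈ts with ∈-postorderL⁻ ts y∈ts
  ... | j , y∈tⱼ with index t∈ts ≟ j
  ...   | yes refl = subst (λ t → _ ∈ postorder t) (sym (lookup-index t∈ts)) y∈tⱼ
  ...   | no i≢j   = ⊥-elim (separated sd i≢j (subst (λ t → _ ∈ postorder t) (lookup-index t∈ts) x∈t) y∈tⱼ e)
    where
    separated : ∀ {X ts} → SD E (node X ts) → ∀ {i j : Fin (length ts)} → i ≢ j → ∀ {a b} →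
                a ∈ vertsOf (lookup ts i) → b ∈ vertsOf (lookup ts j) → ¬ E a b
    separated (inner _ _ _ _ sep _) i≢j = sep _ _ i≢j _ _

  -- C collects the later siblings of the nodes on the way from t down to s
  -- and the separators of the proper ancestors of s.
  SD-subtree-split : ∀ {s t} → SD E t → SubtreeOf s t →
    ∃₂ λ A C → postorder t ≡ A ++ postorder s ++ C ×
               (∀ {x y} → x ∈ postorder s → E x y → y ∉ postorder s → y ∈ postorder t → y ∈ C)
  SD-subtree-split sd here = [] , [] , sym (++-identityʳ _) , λ _ _ y∉s y∈s → ⊥-elim (y∉s y∈s)
  SD-subtree-split {s} {node X ts} sd (there {t = t} t∈ts sub)
    with SD-subtree-split (SD-child sd t∈ts) sub | ∈-∃++ t∈ts
  ... | A , C , split , leave | ts₁ , ts₂ , refl =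
    postorderL ts₁ ++ A , C ++ postorderL ts₂ ++ X , split′ , leave′
    where
    split′ : postorderL (ts₁ ++ t ∷ ts₂) ++ X ≡ (postorderL ts₁ ++ A) ++ postorder s ++ C ++ postorderL ts₂ ++ X
    split′ = begin
      postorderL (ts₁ ++ t ∷ ts₂) ++ X
        ≡⟨ cong (_++ X) (postorderL-++ ts₁ (t ∷ ts₂)) ⟩
      (postorderL ts₁ ++ postorder t ++ postorderL ts₂) ++ X
        ≡⟨ cong (λ l → (postorderL ts₁ ++ l ++ postorderL ts₂) ++ X) split ⟩
      (postorderL ts₁ ++ (A ++ postorder s ++ C) ++ postorderL ts₂) ++ X
        ≡⟨ reassociate (postorderL ts₁) A (postorder s) C (postorderL ts₂) X ⟩
      (postorderL ts₁ ++ A) ++ postorder s ++ C ++ postorderL ts₂ ++ X ∎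
      where
      open ≡-Reasoning
      reassociate : (P₁ A S C P₂ X : List (Fin n)) →
        (P₁ ++ (A ++ S ++ C) ++ P₂) ++ X ≡ (P₁ ++ A) ++ S ++ C ++ P₂ ++ X
      reassociate P₁ A S C P₂ X = solve (++-monoid (Fin n))
    leave′ : ∀ {x y} → x ∈ postorder s → E x y → y ∉ postorder s →
             y ∈ postorder (node X (ts₁ ++ t ∷ ts₂)) → y ∈ C ++ postorderL ts₂ ++ X
    leave′ x∈s e y∉s y∈t with ∈-++⁻ (postorderL (ts₁ ++ t ∷ ts₂)) y∈t
    ... | inj₁ y∈ts = ∈-++⁺ˡ (leave x∈s e y∉s (SD-neighbour-in-children sd t∈ts (SubtreeOf⇒⊆ sub x∈s) e y∈ts))
    ... | inj₂ y∈X  = ∈-++⁺ʳ C (∈-++⁺ʳ (postorderL ts₂) y∈X)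

module NestedDissection {n} {E : Graph n} {T : Tree n} {π rank : Fin n → Fin n}
                        (decomposition : SeparatorDecomposition E T)
                        (order : NestedDissectionOrder T π rank) where

  private
    r : Fin n → ℕ
    r x = toℕ (rank x)

    unique : Unique (postorder T)
    unique = proj₁ decomposition

    covers : ∀ v → v ∈ postorder T
    covers = proj₁ (proj₂ decomposition)

    sd : SD E T
    sd = proj₂ (proj₂ decomposition)

    rπ : ∀ v → π (rank v) ≡ v
    rπ = proj₁ (proj₂ order)

    tabulate-π : tabulate π ≡ postorder T
    tabulate-π = proj₂ (proj₂ order)

  rank-injective : ∀ {x y} → r x ≡ r y → x ≡ y
  rank-injective {x} {y} eq = begin
    x             ≡⟨ sym (rπ x) ⟩
    π (rank x)    ≡⟨ cong π (toℕ-injective eq) ⟩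
    π (rank y)    ≡⟨ rπ y ⟩
    y             ∎
    where
    open ≡-Reasoning

  postorder-[]=-rank : ∀ v → postorder T [ r v ]= v
  postorder-[]=-rank v =
    subst (_[ r v ]= v) tabulate-π (subst (tabulate π [ r v ]=_) (rπ v) (tabulate-[]= π (rank v)))

  boundary-above : ∀ {s v x y} → SubtreeOf s T → v ∈ postorder s →
                   x ∈ postorder s → E x y → y ∉ postorder s → r v < r y
  boundary-above {s} {v} {y = y} sub v∈s x∈s e y∉s with SD-subtree-split sd sub
  ... | A , C , split , leave =
    unique-++-[]=-< (A ++ postorder s) (subst Unique split′ unique) (∈-++⁺ʳ A v∈s)
                    (leave x∈s e y∉s (covers y)) (position v) (position y)
    where
    split′ : postorder T ≡ (A ++ postorder s) ++ C
    split′ = trans split (sym (++-assoc A (postorder s) C))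
    position : ∀ z → (A ++ postorder s) ++ C [ r z ]= z
    position z = subst (_[ r z ]= z) split′ (postorder-[]=-rank z)

module Paths {n} (E : Graph n) where

  data Path (P : Pred (Fin n) _) : Fin n → Fin n → Set where
    edge : ∀ {a b} → E a b → Path P a b
    step : ∀ {a x b} → E a x → P x → Path P x b → Path P a b

  Path-map : ∀ {P Q} → P ⊆ Q → ∀ {a b} → Path P a b → Path Q a b
  Path-map P⊆Q (edge e)      = edge e
  Path-map P⊆Q (step e px p) = step e (P⊆Q px) (Path-map P⊆Q p)

  Path-join : ∀ {P a v b} → Path P a v → P v → Path P v b → Path P a b
  Path-join (edge e)      pv q = step e pv q
  Path-join (step e px p) pv q = step e px (Path-join p pv q)

  firstAndLastVisit : ∀ {P Q} → Decidable Q → ∀ {a b} → Path P a b →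
    Path (P ∩ ∁ Q) a b ⊎ ∃₂ λ v v′ → Q v × Q v′ × Path (P ∩ ∁ Q) a v × Path (P ∩ ∁ Q) v′ b
  firstAndLastVisit Q? (edge e) = inj₁ (edge e)
  firstAndLastVisit Q? (step {x = x} e px p) with Q? x | firstAndLastVisit Q? p
  ... | no ¬qx | inj₁ q                               = inj₁ (step e (px , ¬qx) q)
  ... | no ¬qx | inj₂ (v , v′ , qv , qv′ , q₁ , q₂) = inj₂ (v , v′ , qv , qv′ , step e (px , ¬qx) q₁ , q₂)
  ... | yes qx | inj₁ q                               = inj₂ (x , x , qx , qx , edge e , q)
  ... | yes qx | inj₂ (_ , v′ , _ , qv′ , _ , q₂)    = inj₂ (x , v′ , qx , qv′ , edge e , q₂)

  Star-Induced⇒Path : ∀ {S a v b} → Star (Induced E S) a v → E v b → Path (_∈ S) a b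
  Star-Induced⇒Path ε                       e = edge e
  Star-Induced⇒Path ((_ , x∈S , e′) ◅ path) e = step e′ x∈S (Star-Induced⇒Path path e)

  Path-last-edge : ∀ {S P : Pred (Fin n) _} → (∀ {x y} → S x → E x y → P y → S y) →
                   ∀ {a b} → S a → Path P a b → ∃ λ v → S v × E v b
  Path-last-edge closed sa (edge e)      = _ , sa , e
  Path-last-edge closed sa (step e px p) = Path-last-edge closed (closed sa e px) p

module Contraction {n} (E : Graph n) (bidirected : Bidirected E) (rank : Fin n → Fin n)
                   (rank-injective : ∀ {x y} → toℕ (rank x) ≡ toℕ (rank y) → x ≡ y) where

  open Paths E

  private
    r : Fin n → ℕ
    r x = toℕ (rank x)

    Cur′ : ℕ → Graph n
    Cur′ = Cur E rank

  Cur-sym : ∀ k {a b} → Cur′ k a b → Cur′ k b a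
  Cur-sym zero    e = bidirected _ _ e
  Cur-sym (suc k) (inj₁ c) = inj₁ (Cur-sym k c)
  Cur-sym (suc k) (inj₂ (v , rv≡k , cva , cvb , k<ra , k<rb , a≢b)) =
    inj₂ (v , rv≡k , cvb , cva , k<rb , k<ra , λ b≡a → a≢b (sym b≡a))

  Cur-mono : ∀ {k m a b} → k ≤′ m → Cur′ k a b → Cur′ m a b
  Cur-mono ≤′-refl       c = c
  Cur-mono (≤′-step k≤m) c = inj₁ (Cur-mono k≤m c)

  Cur-settled : ∀ {m a b} → r a ≤′ m → Cur′ m a b → Cur′ (r a) a b
  Cur-settled ≤′-refl        c        = c
  Cur-settled (≤′-step ra≤m) (inj₁ c) = Cur-settled ra≤m c
  Cur-settled (≤′-step ra≤m) (inj₂ (_ , _ , _ , _ , m<ra , _)) = ⊥-elim (<⇒≱ m<ra (≤′⇒≤ ra≤m))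

  Cur⇒Path : ∀ k {a b} → Cur′ k a b → Path (λ x → r x < k) a b
  Cur⇒Path zero    e        = edge e
  Cur⇒Path (suc k) (inj₁ c) = Path-map m<n⇒m<1+n (Cur⇒Path k c)
  Cur⇒Path (suc k) (inj₂ (v , rv≡k , cva , cvb , _)) =
    Path-join (Path-map m<n⇒m<1+n (Cur⇒Path k (Cur-sym k cva)))
              (s≤s (≤-reflexive rv≡k))
              (Path-map m<n⇒m<1+n (Cur⇒Path k cvb))

  private
    below : ∀ {k x} → r x < suc k × r x ≢ k → r x < k
    below (rx≤k , rx≢k) = ≤∧≢⇒< (≤-pred rx≤k) rx≢k

  -- Fill-path lemma.  Since rank is injective, the first and the last vertex of
  -- rank k on the path coincide: it is the vertex whose contraction adds a–b.
  Path⇒Cur : ∀ k {a b} → a ≢ b → k ≤ r a → k ≤ r b → Path (λ x → r x < k) a b → Cur′ k a b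
  Path⇒Cur zero    a≢b _ _ (edge e)      = e
  Path⇒Cur zero    _   _ _ (step _ () _)
  Path⇒Cur (suc k) {a} {b} a≢b k<ra k<rb p with firstAndLastVisit (λ x → r x ≟ℕ k) p
  ... | inj₁ q = inj₁ (Path⇒Cur k a≢b (<⇒≤ k<ra) (<⇒≤ k<rb) (Path-map below q))
  ... | inj₂ (v , v′ , rv≡k , rv′≡k , q₁ , q₂) with rank-injective (trans rv′≡k (sym rv≡k))
  ...   | refl = inj₂ (v , rv≡k ,
                       Cur-sym k (Path⇒Cur k a≢v (<⇒≤ k<ra) (≤-reflexive (sym rv≡k)) (Path-map below q₁)) ,
                       Path⇒Cur k v≢b (≤-reflexive (sym rv≡k)) (<⇒≤ k<rb) (Path-map below q₂) ,
                       k<ra , k<rb , a≢b)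
    where
    a≢v : a ≢ v
    a≢v refl = <-irrefl (sym rv≡k) k<ra
    v≢b : v ≢ b
    v≢b refl = <-irrefl (sym rv≡k) k<rb

  private
    rank<n : ∀ a → r a ≤′ n
    rank<n a = ≤⇒≤′ (<⇒≤ (toℕ<n (rank a)))

  H⇒Path : ∀ {a b} → H E rank a b → Path (λ x → r x < r a) a b
  H⇒Path {a} h = Cur⇒Path (r a) (Cur-settled (rank<n a) h)

  Path⇒H : ∀ {a b} → a ≢ b → r a ≤ r b → Path (λ x → r x < r a) a b → H E rank a b
  Path⇒H {a} a≢b ra≤rb p = Cur-mono (rank<n a) (Path⇒Cur (r a) a≢b ≤-refl ra≤rb p)

  neighbour⇒H : ∀ {S u v w} → StronglyConnectedOn E S → u ∈ S → (∀ x → x ∈ S → r x ≤ r u) →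
                v ∈ S → E v w → r u < r w → H E rank u w
  neighbour⇒H {S} {u} {v} {w} connected u∈S highest v∈S e ru<rw =
    Path⇒H u≢w (<⇒≤ ru<rw) (Path-map below-u (avoiding-u (Star-Induced⇒Path (connected u v u∈S v∈S) e)))
    where
    u≢w : u ≢ w
    u≢w refl = <-irrefl refl ru<rw
    below-u : ∀ {x} → x ∈ S × x ≢ u → r x < r u
    below-u (x∈S , x≢u) = ≤∧≢⇒< (highest _ x∈S) (λ rx≡ru → x≢u (rank-injective rx≡ru))
    avoiding-u : Path (_∈ S) u w → Path ((_∈ S) ∩ ∁ (_≡ u)) u w
    avoiding-u p with firstAndLastVisit (_≟ u) p
    ... | inj₁ q                            = q
    ... | inj₂ (_ , _ , _ , refl , _ , q) = q

  H⇒neighbour : ∀ {S u w} → u ∈ S → (∀ {x y} → x ∈ S → E x y → y ∉ S → r u < r y) →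
                H E rank u w → ∃ λ v → v ∈ S × E v w
  H⇒neighbour {S} {u} u∈S leaving-above h = Path-last-edge stays-in-S u∈S (H⇒Path h)
    where
    stays-in-S : ∀ {x y} → x ∈ S → E x y → r y < r u → y ∈ S
    stays-in-S {y = y} x∈S e ry<ru with DecMembership._∈?_ _≟_ y S
    ... | yes y∈S = y∈S
    ... | no y∉S  = ⊥-elim (<⇒≱ ry<ru (<⇒≤ (leaving-above x∈S e y∉S)))

theorem2 : ∀ {n} (E : Graph n) → Bidirected E → StronglyConnected E →
    (T : Tree n) → SeparatorDecomposition E T →
    (π rank : Fin n → Fin n) → NestedDissectionOrder T π rank →
    (s : Tree n) → SubtreeOf s T →
    (u : Fin n) → HighestIn rank s u →
    ∀ w → (Boundary E s w → UpperNeighbour E rank u w) × (UpperNeighbour E rank u w → Boundary E s w)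
theorem2 E bidirected connected T decomposition@(_ , covers , sd) π rank order s sub u (u∈s , highest) w =
  boundary⇒upper , upper⇒boundary
  where
  open NestedDissection decomposition order
  open Contraction E bidirected rank rank-injective

  boundary⇒upper : Boundary E s w → UpperNeighbour E rank u w
  boundary⇒upper (w∉s , v , v∈s , e) = neighbour⇒H s-connected u∈s highest v∈s e ru<rw , ru<rw
    where
    ru<rw : toℕ (rank u) < toℕ (rank w)
    ru<rw = boundary-above sub u∈s v∈s e w∉s
    s-connected : StronglyConnectedOn E (vertsOf s)
    s-connected = SD-subtree-connected sd (StronglyConnected⇒StronglyConnectedOn covers connected) sub

  upper⇒boundary : UpperNeighbour E rank u w → Boundary E s w
  upper⇒boundary (h , ru<rw) =
    (λ w∈s → <⇒≱ ru<rw (highest w w∈s)) , H⇒neighbour u∈s (boundary-above sub u∈s) h
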